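{- For positive integers $n,k$ and a nonnegative integer $s$, the number of $k$-tuples $(\alpha^1,\ldots,\alpha^k)$ of overpartitions with $|\alpha^1|+\cdots+|\alpha^k|=n$ and exactly $s$ overlined parts in total equals the number of unrestricted Schmidt $k$-overpartitions of $n$ with exactly $s$ overlined parts.
   Context: An overpartition is a partition (finite weakly decreasing sequence of positive integers, possibly empty) in which the final occurrence of each part value may be overlined; $|\cdot|$ is the sum of its parts. An unrestricted Schmidt $k$-overpartition of $n$ is an overpartition $(\lambda_1,\lambda_2,\ldots)$ with $\lambda_1+\lambda_{k+1}+\lambda_{2k+1}+\cdots=n$. -}

module Defs where

open import Data.Nat using (ℕ; zero; suc; _+_; _∸_; _≤ᵇ_; _<ᵇ_)
open import Data.Bool using (Bool; true; false; _∧_; if_then_else_; T)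
open import Data.List using (List; []; _∷_)
open import Data.Vec using (Vec; []; _∷_)
open import Data.Product using (_×_; _,_; Σ)
open import Relation.Binary.PropositionalEquality using (_≡_)

-- An overpartition is represented as the list of its parts in order
-- (λ₁, λ₂, …), each part paired with a flag saying whether it is overlined.
Part : Set
Part = ℕ × Bool

-- Validity: parts positive, weakly decreasing, and an overlined part is the
-- final occurrence of its value (the next part, if any, is strictly smaller).
isOverpartition : List Part → Bool
isOverpartition [] = true
isOverpartition ((a , b) ∷ []) = 1 ≤ᵇ a
isOverpartition ((a , b) ∷ (c , d) ∷ rest) =
  (1 ≤ᵇ a) ∧ (c ≤ᵇ a) ∧ (if b then c <ᵇ a else true) ∧ isOverpartition ((c , d) ∷ rest)

Overpartition : Set
Overpartition = Σ (List Part) (λ xs → T (isOverpartition xs))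

size : List Part → ℕ
size [] = 0
size ((a , _) ∷ xs) = a + size xs

overlined : List Part → ℕ
overlined [] = 0
overlined ((_ , true) ∷ xs) = suc (overlined xs)
overlined ((_ , false) ∷ xs) = overlined xs

allOverpartitions : {k : ℕ} → Vec (List Part) k → Bool
allOverpartitions [] = true
allOverpartitions (x ∷ xs) = isOverpartition x ∧ allOverpartitions xs

sizeTuple : {k : ℕ} → Vec (List Part) k → ℕ
sizeTuple [] = 0
sizeTuple (x ∷ xs) = size x + sizeTuple xs

overlinedTuple : {k : ℕ} → Vec (List Part) k → ℕ
overlinedTuple [] = 0
overlinedTuple (x ∷ xs) = overlined x + overlinedTuple xs

-- Schmidt k-weight: λ₁ + λ_{k+1} + λ_{2k+1} + ⋯  (positions 1, k+1, 2k+1, …).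
-- schmidtGo k j xs: skip j parts, then take one and restart with skip k-1.
schmidtGo : ℕ → ℕ → List Part → ℕ
schmidtGo k j [] = 0
schmidtGo k zero ((a , _) ∷ xs) = a + schmidtGo k (k ∸ 1) xs
schmidtGo k (suc j) (_ ∷ xs) = schmidtGo k j xs

schmidtWeight : ℕ → List Part → ℕ
schmidtWeight k xs = schmidtGo k 0 xs

TupleSet : (k n s : ℕ) → Set
TupleSet k n s = Σ (Vec (List Part) k) (λ v →
  T (allOverpartitions v) × sizeTuple v ≡ n × overlinedTuple v ≡ s)

SchmidtSet : (k n s : ℕ) → Set
SchmidtSet k n s = Σ (List Part) (λ xs →
  T (isOverpartition xs) × schmidtWeight k xs ≡ n × overlined xs ≡ s)

-- An overpartition λ₁ ≥ λ₂ ≥ ⋯ ≥ λ_L is determined by its gaps δᵢ = λᵢ − λᵢ₊₁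
-- (with λ_{L+1} = 0), an overlined part having a positive gap; this identifies
-- overpartitions with sequences of (flagged) gaps up to trailing zeros.  Since
-- λⱼ = Σ_{i ≥ j} δᵢ, the gap at (0-based) position i contributes (i + 1)·δᵢ to
-- |λ| and (⌊i/k⌋ + 1)·δᵢ to the Schmidt weight λ₁ + λ_{k+1} + ⋯.  Cutting one
-- gap sequence into rows of length k and reading off its k columns therefore
-- turns the Schmidt weight of one overpartition into the total size of k
-- overpartitions, and flags (overlined parts) are just moved around.
module Submission where

open import Defs
open import Axiom.UniquenessOfIdentityProofs using (module Decidable⇒UIP)
open import Data.Bool using (Bool; true; false; T; if_then_else_)
open import Data.Bool.Properties using (T-∧; T-irrelevant)
import Data.Bool.Properties as Bool
open import Data.Fin using (Fin; toℕ)
open import Data.Fin.Properties using (toℕ<n)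
open import Data.List using (List; []; _∷_; _++_; length; map; applyUpTo; tabulate; concatMap)
open import Data.List.Properties using (length-tabulate; map-applyUpTo)
import Data.List.Properties as List
open import Data.Nat
  using (ℕ; zero; suc; _+_; _*_; _∸_; _≤_; _<_; _<ᵇ_; z≤n; s≤s; pred; NonZero; >-nonZero)
open import Data.Nat.DivMod using (_divMod_; result)
open import Data.Nat.Properties
open import Data.Nat.Solver using (module +-*-Solver)
open import Data.Product using (_×_; _,_; proj₁; proj₂; Σ)
import Data.Product.Properties as Product
open import Data.Unit using (tt)
open import Data.Vec using (Vec; lookup)
import Data.Vec as Vec
import Data.Vec.Properties as Vec
open import Data.Vec.Functional using (Vector)
open import Function using (_∘_; _⇔_; mk⇔; Equivalence; _↔_; mk↔ₛ′)
open import Function.Properties.Inverse using (↔-sym; ↔-trans)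
open import Relation.Binary.Definitions using (DecidableEquality)
open import Relation.Binary.PropositionalEquality
open import Relation.Nullary using (Irrelevant; contradiction; yes; no)

open import Algebra.Properties.CommutativeMonoid.Sum +-0-commutativeMonoid
  using (sum; sum-syntax; ∑-distrib-+; sum-cong-≗; sum-replicate-zero)
open import Algebra.Properties.Semiring.Sum +-*-semiring using (*-distribˡ-sum)
open +-*-Solver using (solve; _:+_; _:*_; _:=_; con)

private variable
  A : Set

↔-restrict : {A B : Set} {P : A → Set} {Q : B → Set} →
  (∀ {a} → Irrelevant (P a)) → (∀ {b} → Irrelevant (Q b)) →
  (f : A → B) (g : B → A) → (∀ {a} → P a → Q (f a)) → (∀ {b} → Q b → P (g b)) →
  (∀ {a} → P a → g (f a) ≡ a) → (∀ {b} → Q b → f (g b) ≡ b) →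
  Σ A P ↔ Σ B Q
↔-restrict P-irr Q-irr f g f-P g-Q g∘f f∘g =
  mk↔ₛ′ (λ (a , p) → f a , f-P p) (λ (b , q) → g b , g-Q q)
        (λ (b , q) → Σ-≡ Q-irr (f∘g q)) (λ (a , p) → Σ-≡ P-irr (g∘f p))
  where
  Σ-≡ : ∀ {X : Set} {R : X → Set} → (∀ {x} → Irrelevant (R x)) →
        ∀ {x y} {r : R x} {r′ : R y} → x ≡ y → (x , r) ≡ (y , r′)
  Σ-≡ irr {r = r} {r′} refl = cong (_ ,_) (irr r r′)

statistics-irrelevant : ∀ {V : Set} {m n k s : ℕ} → Irrelevant V → Irrelevant (V × m ≡ n × k ≡ s)
statistics-irrelevant V-irr (v , p , q) (v′ , p′ , q′) =
  cong₂ _,_ (V-irr v v′) (cong₂ _,_ (≡-irrelevant p p′) (≡-irrelevant q q′))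

weightedSum : (ℕ → ℕ) → (A → ℕ) → List A → ℕ
weightedSum c w [] = 0
weightedSum c w (x ∷ l) = c 0 * w x + weightedSum (c ∘ suc) w l

total : (A → ℕ) → List A → ℕ
total = weightedSum (λ _ → 1)

concatRows : ∀ {k} → List (Vector A k) → List A
concatRows = concatMap tabulate

weightedSum-+ᶜ : ∀ c c′ (w : A → ℕ) l →
  weightedSum (λ i → c i + c′ i) w l ≡ weightedSum c w l + weightedSum c′ w l
weightedSum-+ᶜ c c′ w [] = refl
weightedSum-+ᶜ c c′ w (x ∷ l)
  rewrite weightedSum-+ᶜ (c ∘ suc) (c′ ∘ suc) w l | *-distribʳ-+ (w x) (c 0) (c′ 0) =
  solve 4 (λ a b s t → a :+ b :+ (s :+ t) := a :+ s :+ (b :+ t)) refl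
    (c 0 * w x) (c′ 0 * w x) (weightedSum (c ∘ suc) w l) (weightedSum (c′ ∘ suc) w l)

total-++ : ∀ (w : A → ℕ) xs ys → total w (xs ++ ys) ≡ total w xs + total w ys
total-++ w [] ys = refl
total-++ w (x ∷ xs) ys rewrite total-++ w xs ys = sym (+-assoc (1 * w x) _ _)

total-tabulate : ∀ {k} (w : A → ℕ) (r : Vector A k) → total w (tabulate r) ≡ ∑[ j < k ] w (r j)
total-tabulate {k = zero} w r = refl
total-tabulate {k = suc k} w r =
  cong₂ _+_ (*-identityˡ (w (r Fin.zero))) (total-tabulate w (r ∘ Fin.suc))

total-concatRows : ∀ {k} (w : A → ℕ) (rows : List (Vector A k)) →
  total w (concatRows rows) ≡ total (λ r → ∑[ j < k ] w (r j)) rows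
total-concatRows w [] = refl
total-concatRows {k = k} w (r ∷ rows) = begin
  total w (tabulate r ++ concatRows rows)           ≡⟨ total-++ w (tabulate r) (concatRows rows) ⟩
  total w (tabulate r) + total w (concatRows rows)
    ≡⟨ cong₂ _+_ (trans (total-tabulate w r) (sym (*-identityˡ _))) (total-concatRows w rows) ⟩
  total (λ r → ∑[ j < k ] w (r j)) (r ∷ rows)       ∎
  where open ≡-Reasoning

weightedSum-∑ : ∀ {k} c (w : A → ℕ) (rows : List (Vector A k)) →
  weightedSum c (λ r → ∑[ j < k ] w (r j)) rows ≡ ∑[ j < k ] weightedSum c w (map (λ r → r j) rows)
weightedSum-∑ {k = k} c w [] = sym (sum-replicate-zero k)
weightedSum-∑ {k = k} c w (r ∷ rows) = begin
  c 0 * ∑[ j < k ] w (r j) + weightedSum (c ∘ suc) (λ r → ∑[ j < k ] w (r j)) rows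
    ≡⟨ cong₂ _+_ (*-distribˡ-sum (c 0) (w ∘ r)) (weightedSum-∑ (c ∘ suc) w rows) ⟩
  ∑[ j < k ] (c 0 * w (r j)) + ∑[ j < k ] weightedSum (c ∘ suc) w (map (λ r → r j) rows)
    ≡⟨ ∑-distrib-+ (λ j → c 0 * w (r j))
                   (λ j → weightedSum (c ∘ suc) w (map (λ r → r j) rows)) ⟨
  ∑[ j < k ] weightedSum c w (map (λ r → r j) (r ∷ rows))  ∎
  where open ≡-Reasoning

-- Lists over A are read as sequences ℕ → A padded with o; the canonical
-- representative of such a sequence carries no trailing o.
module Sequences {A : Set} (o : A) (_≟_ : DecidableEquality A) where

  infixl 9 _!_
  _!_ : List A → ℕ → A
  [] ! i = o
  (x ∷ l) ! zero = x
  (x ∷ l) ! suc i = l ! i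

  !-beyond : ∀ l {i} → length l ≤ i → l ! i ≡ o
  !-beyond [] _ = refl
  !-beyond (x ∷ l) {suc i} (s≤s l≤i) = !-beyond l l≤i

  !-applyUpTo : ∀ {f : ℕ → A} n → (∀ i → n ≤ i → f i ≡ o) → ∀ i → applyUpTo f n ! i ≡ f i
  !-applyUpTo zero vanish i = sym (vanish i z≤n)
  !-applyUpTo (suc n) vanish zero = refl
  !-applyUpTo (suc n) vanish (suc i) = !-applyUpTo n (λ i n≤i → vanish (suc i) (s≤s n≤i)) i

  !-++ʳ : ∀ xs {ys} i → (xs ++ ys) ! (length xs + i) ≡ ys ! i
  !-++ʳ [] i = refl
  !-++ʳ (x ∷ xs) i = !-++ʳ xs i

  !-++ˡ : ∀ xs {ys i} → i < length xs → (xs ++ ys) ! i ≡ xs ! i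
  !-++ˡ (x ∷ xs) {i = zero} _ = refl
  !-++ˡ (x ∷ xs) {i = suc i} (s≤s i<n) = !-++ˡ xs i<n

  !-tabulate : ∀ {n} (f : Fin n → A) j → tabulate f ! toℕ j ≡ f j
  !-tabulate f Fin.zero = refl
  !-tabulate f (Fin.suc j) = !-tabulate (f ∘ Fin.suc) j

  infixr 5 _∷ᵒ_
  _∷ᵒ_ : A → List A → List A
  x ∷ᵒ [] with x ≟ o
  ... | yes _ = []
  ... | no _ = x ∷ []
  x ∷ᵒ (y ∷ l) = x ∷ y ∷ l

  strip : List A → List A
  strip [] = []
  strip (x ∷ l) = x ∷ᵒ strip l

  !-∷ᵒ : ∀ x l i → (x ∷ᵒ l) ! i ≡ (x ∷ l) ! i
  !-∷ᵒ x (y ∷ l) i = refl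
  !-∷ᵒ x [] i with x ≟ o
  !-∷ᵒ x [] zero | yes x≡o = sym x≡o
  !-∷ᵒ x [] (suc i) | yes _ = refl
  ... | no _ = refl

  !-strip : ∀ l i → strip l ! i ≡ l ! i
  !-strip [] i = refl
  !-strip (x ∷ l) i = trans (!-∷ᵒ x (strip l) i) (!-∷-strip i)
    where
    !-∷-strip : ∀ i → (x ∷ strip l) ! i ≡ (x ∷ l) ! i
    !-∷-strip zero = refl
    !-∷-strip (suc i) = !-strip l i

  o∷ᵒ[] : o ∷ᵒ [] ≡ []
  o∷ᵒ[] with o ≟ o
  ... | yes _ = refl
  ... | no o≢o = contradiction refl o≢o

  ∷ᵒ-[] : ∀ {x} → x ≢ o → x ∷ᵒ [] ≡ x ∷ []
  ∷ᵒ-[] {x} x≢o with x ≟ o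
  ... | yes x≡o = contradiction x≡o x≢o
  ... | no _ = refl

  strip-vanishing : ∀ l → (∀ i → l ! i ≡ o) → strip l ≡ []
  strip-vanishing [] _ = refl
  strip-vanishing (x ∷ l) vanish
    rewrite vanish zero | strip-vanishing l (vanish ∘ suc) = o∷ᵒ[]

  strip-cong : ∀ l l′ → (∀ i → l ! i ≡ l′ ! i) → strip l ≡ strip l′
  strip-cong [] l′ eq = sym (strip-vanishing l′ (sym ∘ eq))
  strip-cong l@(_ ∷ _) [] eq = strip-vanishing l eq
  strip-cong (x ∷ l) (x′ ∷ l′) eq = cong₂ _∷ᵒ_ (eq zero) (strip-cong l l′ (eq ∘ suc))

  Canonical : List A → Set
  Canonical l = strip l ≡ l

  canonical-irrelevant : ∀ {l} → Irrelevant (Canonical l)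
  canonical-irrelevant = Decidable⇒UIP.≡-irrelevant (List.≡-dec _≟_)

  strip-canonical : ∀ l → Canonical (strip l)
  strip-canonical l = strip-cong (strip l) l (!-strip l)

  canonical-ext : ∀ {l l′} → Canonical l → Canonical l′ → (∀ i → l ! i ≡ l′ ! i) → l ≡ l′
  canonical-ext {l} {l′} cl cl′ eq = trans (sym cl) (trans (strip-cong l l′ eq) cl′)

  canonical-∷⁻ : ∀ {x l} → Canonical (x ∷ l) → Canonical l
  canonical-∷⁻ {x} {l} eq with strip l | eq
  ... | y ∷ l′ | refl = refl
  ... | [] | eq′ with x ≟ o | eq′
  ...   | yes _ | ()
  ...   | no _ | eq″ = List.∷-injectiveʳ eq″

  canonical-[x]⇒x≢o : ∀ {x} → Canonical (x ∷ []) → x ≢ o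
  canonical-[x]⇒x≢o {x} eq with x ≟ o | eq
  ... | yes _ | ()
  ... | no x≢o | _ = x≢o

  weightedSum-∷ᵒ : ∀ {c w} → w o ≡ 0 → ∀ x l → weightedSum c w (x ∷ᵒ l) ≡ weightedSum c w (x ∷ l)
  weightedSum-∷ᵒ w-o x (y ∷ l) = refl
  weightedSum-∷ᵒ {c} {w} w-o x [] with x ≟ o
  ... | no _ = refl
  ... | yes refl rewrite w-o | *-zeroʳ (c 0) = refl

  weightedSum-strip : ∀ {c w} → w o ≡ 0 → ∀ l → weightedSum c w (strip l) ≡ weightedSum c w l
  weightedSum-strip w-o [] = refl
  weightedSum-strip {c} {w} w-o (x ∷ l) =
    trans (weightedSum-∷ᵒ w-o x (strip l)) (cong (c 0 * w x +_) (weightedSum-strip w-o l))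

  weightedSum-applyUpTo : ∀ {c w} → w o ≡ 0 → ∀ {M} l → length l ≤ M →
    weightedSum c w (applyUpTo (l !_) M) ≡ weightedSum c w l
  weightedSum-applyUpTo {c} {w} w-o {M} l l≤M = begin
    weightedSum c w (applyUpTo (l !_) M)
      ≡⟨ weightedSum-strip {c} w-o (applyUpTo (l !_) M) ⟨
    weightedSum c w (strip (applyUpTo (l !_) M))
      ≡⟨ cong (weightedSum c w) (strip-cong (applyUpTo (l !_) M) l padded) ⟩
    weightedSum c w (strip l)
      ≡⟨ weightedSum-strip {c} w-o l ⟩
    weightedSum c w l ∎
    where
    open ≡-Reasoning
    padded : ∀ i → applyUpTo (l !_) M ! i ≡ l ! i
    padded = !-applyUpTo M (λ i M≤i → !-beyond l (≤-trans l≤M M≤i))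

  CanonicalTuple : ∀ {k} → Vec (List A) k → Set
  CanonicalTuple v = Vec.map strip v ≡ v

  canonicalTuple-irrelevant : ∀ {k} {v : Vec (List A) k} → Irrelevant (CanonicalTuple v)
  canonicalTuple-irrelevant = Decidable⇒UIP.≡-irrelevant (Vec.≡-dec (List.≡-dec _≟_))

  canonicalTuple-lookup : ∀ {k} {v : Vec (List A) k} → CanonicalTuple v → ∀ j → Canonical (lookup v j)
  canonicalTuple-lookup {v = v} eq j = trans (sym (Vec.lookup-map j strip v)) (cong (λ u → lookup u j) eq)

  height : ∀ {k} → Vec (List A) k → ℕ
  height Vec.[] = 0
  height (c Vec.∷ v) = length c + height v

  length≤height : ∀ {k} (v : Vec (List A) k) j → length (lookup v j) ≤ height v
  length≤height (c Vec.∷ v) Fin.zero = m≤m+n (length c) (height v)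
  length≤height (c Vec.∷ v) (Fin.suc j) = ≤-trans (length≤height v j) (m≤n+m (height v) (length c))

  rows : ∀ {k} → Vec (List A) k → List (Vector A k)
  rows v = applyUpTo (λ q j → lookup v j ! q) (height v)

  interleave : ∀ {k} → Vec (List A) k → List A
  interleave v = strip (concatRows (rows v))

  !-concatRows : ∀ {k} M (r : ℕ → Vector A k) → (∀ q → M ≤ q → ∀ j → r q j ≡ o) →
    ∀ q j → concatRows (applyUpTo r M) ! (q * k + toℕ j) ≡ r q j
  !-concatRows zero r vanish q j = sym (vanish q z≤n j)
  !-concatRows (suc M) r vanish zero j =
    trans (!-++ˡ (tabulate (r 0)) (subst (toℕ j <_) (sym (length-tabulate (r 0))) (toℕ<n j)))
          (!-tabulate (r 0) j)
  !-concatRows {k} (suc M) r vanish (suc q) j = begin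
    (tabulate (r 0) ++ rest) ! (k + q * k + toℕ j)
      ≡⟨ cong ((tabulate (r 0) ++ rest) !_)
           (trans (+-assoc k (q * k) (toℕ j)) (cong (_+ (q * k + toℕ j)) (sym (length-tabulate (r 0))))) ⟩
    (tabulate (r 0) ++ rest) ! (length (tabulate (r 0)) + (q * k + toℕ j))
      ≡⟨ !-++ʳ (tabulate (r 0)) (q * k + toℕ j) ⟩
    rest ! (q * k + toℕ j)
      ≡⟨ !-concatRows M (r ∘ suc) (λ q M≤q → vanish (suc q) (s≤s M≤q)) q j ⟩
    r (suc q) j ∎
    where
    open ≡-Reasoning
    rest = concatRows (applyUpTo (r ∘ suc) M)

  !-interleave : ∀ {k} (v : Vec (List A) k) q j → interleave v ! (q * k + toℕ j) ≡ lookup v j ! q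
  !-interleave {k} v q j =
    trans (!-strip (concatRows (rows v)) (q * k + toℕ j)) (!-concatRows (height v) _ vanish q j)
    where
    vanish : ∀ q → height v ≤ q → ∀ j → lookup v j ! q ≡ o
    vanish q h≤q j = !-beyond (lookup v j) (≤-trans (length≤height v j) h≤q)

  weightedSum-rows : ∀ {k c w} → w o ≡ 0 → (v : Vec (List A) k) →
    weightedSum c (λ r → ∑[ j < k ] w (r j)) (rows v) ≡ ∑[ j < k ] weightedSum c w (lookup v j)
  weightedSum-rows {k} {c} {w} w-o v = trans (weightedSum-∑ c w (rows v)) (sum-cong-≗ column-sum)
    where
    column-sum : ∀ j → weightedSum c w (map (λ r → r j) (rows v)) ≡ weightedSum c w (lookup v j)
    column-sum j = trans (cong (weightedSum c w) (map-applyUpTo _ (λ r → r j) (height v)))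
                         (weightedSum-applyUpTo w-o (lookup v j) (length≤height v j))

  module _ (k : ℕ) .{{_ : NonZero k}} where

    stride : List A → Fin k → List A
    stride l j = applyUpTo (λ q → l ! (q * k + toℕ j)) (length l)

    column : List A → Fin k → List A
    column l j = strip (stride l j)

    columns : List A → Vec (List A) k
    columns l = Vec.tabulate (column l)

    !-column : ∀ l j q → column l j ! q ≡ l ! (q * k + toℕ j)
    !-column l j q = trans (!-strip (stride l j) q) (!-applyUpTo (length l) vanish q)
      where
      vanish : ∀ q → length l ≤ q → l ! (q * k + toℕ j) ≡ o
      vanish q l≤q = !-beyond l (≤-trans l≤q (≤-trans (m≤m*n q k) (m≤m+n (q * k) (toℕ j))))

    !-blocks : ∀ l l′ → (∀ q (j : Fin k) → l ! (q * k + toℕ j) ≡ l′ ! (q * k + toℕ j)) →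
      ∀ i → l ! i ≡ l′ ! i
    !-blocks l l′ eq i with i divMod k
    ... | result q j i≡j+qk =
      subst (λ m → l ! m ≡ l′ ! m) (sym (trans i≡j+qk (+-comm (toℕ j) (q * k)))) (eq q j)

    columns-canonical : ∀ l → CanonicalTuple (columns l)
    columns-canonical l =
      trans (sym (Vec.tabulate-∘ strip (column l)))
            (Vec.tabulate-cong (λ j → strip-canonical (stride l j)))

    columns-interleave : ∀ {v} → CanonicalTuple v → columns (interleave v) ≡ v
    columns-interleave {v} cv = trans (Vec.tabulate-cong column≡lookup) (Vec.tabulate∘lookup v)
      where
      column≡lookup : ∀ j → column (interleave v) j ≡ lookup v j
      column≡lookup j = canonical-ext (strip-canonical (stride (interleave v) j)) (canonicalTuple-lookup cv j)
        (λ q → trans (!-column (interleave v) j q) (!-interleave v q j))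

    interleave-columns : ∀ {l} → Canonical l → interleave (columns l) ≡ l
    interleave-columns {l} cl =
      canonical-ext (strip-canonical (concatRows (rows (columns l)))) cl
        (!-blocks (interleave (columns l)) l entries)
      where
      entries : ∀ q j → interleave (columns l) ! (q * k + toℕ j) ≡ l ! (q * k + toℕ j)
      entries q j = begin
        interleave (columns l) ! (q * k + toℕ j) ≡⟨ !-interleave (columns l) q j ⟩
        lookup (columns l) j ! q                ≡⟨ cong (_! q) (Vec.lookup∘tabulate (column l) j) ⟩
        column l j ! q                          ≡⟨ !-column l j q ⟩
        l ! (q * k + toℕ j)                     ∎
        where open ≡-Reasoning

-- (m , b) encodes the gap m + [b] below a part, b recording that the part is
-- overlined; an overlined part is strictly larger than the next one, so its
-- gap is at least 1 and this encoding is a bijection onto the valid gaps.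
Gap : Set
Gap = ℕ × Bool

value : Gap → ℕ
value (m , false) = m
value (m , true) = suc m

flag : Gap → ℕ
flag (_ , false) = 0
flag (_ , true) = 1

_≟ᵍ_ : DecidableEquality Gap
_≟ᵍ_ = Product.≡-dec _≟_ Bool._≟_

open Sequences (0 , false) _≟ᵍ_

Valid : List Part → Set
Valid l = T (isOverpartition l)

largest : List Part → ℕ
largest [] = 0
largest ((a , _) ∷ _) = a

parts : List Gap → List Part
parts [] = []
parts (x ∷ d) = (value x + largest (parts d) , proj₂ x) ∷ parts d

gap : ℕ → Bool → Gap
gap δ false = (δ , false)
gap δ true = (pred δ , true)

gaps : List Part → List Gap
gaps [] = []
gaps ((a , b) ∷ l) = gap (a ∸ largest l) b ∷ gaps l

gaps-parts : ∀ d → gaps (parts d) ≡ d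
gaps-parts [] = refl
gaps-parts (x ∷ d) =
  cong₂ _∷_ (trans (cong (λ δ → gap δ (proj₂ x)) (m+n∸n≡m (value x) (largest (parts d))))
                   (gap-value x))
            (gaps-parts d)
  where
  gap-value : ∀ x → gap (value x) (proj₂ x) ≡ x
  gap-value (m , false) = refl
  gap-value (m , true) = refl

overline-condition⇔ : ∀ b {c a} → T (if b then c <ᵇ a else true) ⇔ (T b → c < a)
overline-condition⇔ true = mk⇔ (λ t _ → <ᵇ⇒< _ _ t) (λ c<a → <⇒<ᵇ (c<a tt))
overline-condition⇔ false = mk⇔ (λ _ ()) (λ _ → tt)

valid-∷∷ : ∀ a b c d l →
  Valid ((a , b) ∷ (c , d) ∷ l) ⇔ (1 ≤ a × c ≤ a × (T b → c < a) × Valid ((c , d) ∷ l))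
valid-∷∷ a b c d l = mk⇔ to from
  where
  Conditions = 1 ≤ a × c ≤ a × (T b → c < a) × Valid ((c , d) ∷ l)
  to : Valid ((a , b) ∷ (c , d) ∷ l) → Conditions
  to v = let (v₁ , v′) = Equivalence.to T-∧ v
             (v₂ , v″) = Equivalence.to T-∧ v′
             (v₃ , v₄) = Equivalence.to T-∧ v″
         in ≤ᵇ⇒≤ 1 a v₁ , ≤ᵇ⇒≤ c a v₂ , Equivalence.to (overline-condition⇔ b) v₃ , v₄
  from : Conditions → Valid ((a , b) ∷ (c , d) ∷ l)
  from (1≤a , c≤a , strict , v) =
    Equivalence.from T-∧ (≤⇒≤ᵇ 1≤a , Equivalence.from T-∧ (≤⇒≤ᵇ c≤a ,
      Equivalence.from T-∧ (Equivalence.from (overline-condition⇔ b) strict , v)))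

valid-tail : ∀ x l → Valid (x ∷ l) → Valid l
valid-tail x [] _ = tt
valid-tail (a , b) ((c , d) ∷ l) v = proj₂ (proj₂ (proj₂ (Equivalence.to (valid-∷∷ a b c d l) v)))

valid-positive : ∀ a b l → Valid ((a , b) ∷ l) → 1 ≤ a
valid-positive a b [] v = ≤ᵇ⇒≤ 1 a v
valid-positive a b ((c , d) ∷ l) v = proj₁ (Equivalence.to (valid-∷∷ a b c d l) v)

valid-step : ∀ a b l → Valid ((a , b) ∷ l) → largest l ≤ a × (T b → largest l < a)
valid-step a b [] v = z≤n , λ _ → valid-positive a b [] v
valid-step a b ((c , d) ∷ l) v =
  let (_ , c≤a , strict , _) = Equivalence.to (valid-∷∷ a b c d l) v in c≤a , strict

value-gap : ∀ {h a} b → h ≤ a → (T b → h < a) → value (gap (a ∸ h) b) + h ≡ a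
value-gap false h≤a _ = m∸n+n≡m h≤a
value-gap {h} {a} true _ h<a =
  trans (cong (_+ h) (suc-pred (a ∸ h) {{>-nonZero (m<n⇒0<n∸m (h<a tt))}}))
        (m∸n+n≡m (<⇒≤ (h<a tt)))

parts-gaps : ∀ l → Valid l → parts (gaps l) ≡ l
parts-gaps [] _ = refl
parts-gaps ((a , b) ∷ l) v rewrite parts-gaps l (valid-tail (a , b) l v) =
  cong (_∷ l) (cong₂ _,_ (value-gap b h≤a h<a) (flag-gap b))
  where
  h≤a = proj₁ (valid-step a b l v)
  h<a = proj₂ (valid-step a b l v)
  flag-gap : ∀ b → proj₂ (gap (a ∸ largest l) b) ≡ b
  flag-gap false = refl
  flag-gap true = refl

gap-≢o : ∀ {δ} b → 1 ≤ δ → gap δ b ≢ (0 , false)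
gap-≢o {suc _} false _ ()
gap-≢o true _ ()

gaps-canonical : ∀ l → Valid l → Canonical (gaps l)
gaps-canonical [] _ = refl
gaps-canonical ((a , b) ∷ []) v = ∷ᵒ-[] (gap-≢o b (valid-positive a b [] v))
gaps-canonical ((a , b) ∷ (c , d) ∷ l) v =
  cong (gap (a ∸ c) b ∷ᵒ_) (gaps-canonical ((c , d) ∷ l) (valid-tail (a , b) ((c , d) ∷ l) v))

value-positive : ∀ {x} → x ≢ (0 , false) → 1 ≤ value x
value-positive {zero , false} x≢o = contradiction refl x≢o
value-positive {suc _ , false} _ = s≤s z≤n
value-positive {_ , true} _ = s≤s z≤n

flagged-value : ∀ x c → T (proj₂ x) → c < value x + c
flagged-value (m , true) c _ = s≤s (m≤n+m c m)

valid-∷⁺ : ∀ x c b l → Valid ((c , b) ∷ l) → Valid ((value x + c , proj₂ x) ∷ (c , b) ∷ l)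
valid-∷⁺ x c b l v = Equivalence.from (valid-∷∷ (value x + c) (proj₂ x) c b l)
  (≤-trans (valid-positive c b l v) (m≤n+m c (value x)) , m≤n+m c (value x) , flagged-value x c , v)

parts-valid : ∀ d → Canonical d → Valid (parts d)
parts-valid [] _ = tt
parts-valid (x ∷ []) cd =
  ≤⇒≤ᵇ (≤-trans (value-positive (canonical-[x]⇒x≢o cd)) (m≤m+n (value x) 0))
parts-valid (x ∷ y ∷ d) cd =
  valid-∷⁺ x (value y + largest (parts d)) (proj₂ y) (parts d)
    (parts-valid (y ∷ d) (canonical-∷⁻ cd))

largest-parts : ∀ d → largest (parts d) ≡ total value d
largest-parts [] = refl
largest-parts (x ∷ d) = cong₂ _+_ (sym (*-identityˡ (value x))) (largest-parts d)

size-parts : ∀ d → size (parts d) ≡ weightedSum suc value d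
size-parts [] = refl
size-parts (x ∷ d) = begin
  value x + largest (parts d) + size (parts d)
    ≡⟨ cong₂ (λ t w → value x + t + w) (largest-parts d) (size-parts d) ⟩
  value x + total value d + weightedSum suc value d
    ≡⟨ +-assoc (value x) _ _ ⟩
  value x + (total value d + weightedSum suc value d)
    ≡⟨ cong₂ _+_ (sym (*-identityˡ (value x))) (sym (weightedSum-+ᶜ (λ _ → 1) suc value d)) ⟩
  weightedSum suc value (x ∷ d) ∎
  where open ≡-Reasoning

overlined-parts : ∀ d → overlined (parts d) ≡ total flag d
overlined-parts [] = refl
overlined-parts ((_ , true) ∷ d) = cong suc (overlined-parts d)
overlined-parts ((_ , false) ∷ d) = overlined-parts d

schmidtGo-parts-++ : ∀ k xs ys → schmidtGo k (length xs) (parts (xs ++ ys)) ≡ schmidtGo k 0 (parts ys)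
schmidtGo-parts-++ k [] ys = refl
schmidtGo-parts-++ k (x ∷ xs) ys = schmidtGo-parts-++ k xs ys

schmidtGo-parts-∷ᵒ : ∀ k j x d → schmidtGo k j (parts (x ∷ᵒ d)) ≡ schmidtGo k j (parts (x ∷ d))
schmidtGo-parts-∷ᵒ k j x (_ ∷ _) = refl
schmidtGo-parts-∷ᵒ k j x [] with x ≟ᵍ (0 , false)
... | no _ = refl
schmidtGo-parts-∷ᵒ k zero x [] | yes refl = refl
schmidtGo-parts-∷ᵒ k (suc j) x [] | yes refl = refl

schmidtGo-parts-strip : ∀ k j d → schmidtGo k j (parts (strip d)) ≡ schmidtGo k j (parts d)
schmidtGo-parts-strip k j [] = refl
schmidtGo-parts-strip k j (x ∷ d) = trans (schmidtGo-parts-∷ᵒ k j x (strip d)) (unstripped j)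
  where
  unstripped : ∀ j → schmidtGo k j (parts (x ∷ strip d)) ≡ schmidtGo k j (parts (x ∷ d))
  unstripped zero = cong₂ (λ t s → value x + t + s)
    (trans (largest-parts (strip d)) (trans (weightedSum-strip refl d) (sym (largest-parts d))))
    (schmidtGo-parts-strip k (k ∸ 1) d)
  unstripped (suc j) = schmidtGo-parts-strip k j d

-- The part heading a row is the total of the gaps from that row on, so the
-- row at position q is counted q + 1 times.
schmidtWeight-parts-concatRows : ∀ k (rows : List (Vector Gap (suc k))) →
  schmidtWeight (suc k) (parts (concatRows rows)) ≡
  weightedSum suc (λ r → ∑[ j < suc k ] value (r j)) rows
schmidtWeight-parts-concatRows k [] = refl
schmidtWeight-parts-concatRows k (r ∷ rows) = begin
  v₀ + largest (parts (xs ++ rest)) + schmidtGo (suc k) k (parts (xs ++ rest))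
    ≡⟨ cong₂ (λ t s → v₀ + t + s)
         (trans (largest-parts (xs ++ rest)) (total-++ value xs rest))
         (trans (cong (λ j → schmidtGo (suc k) j (parts (xs ++ rest)))
                      (sym (length-tabulate (r ∘ Fin.suc))))
                (schmidtGo-parts-++ (suc k) xs rest)) ⟩
  v₀ + (total value xs + total value rest) + schmidtWeight (suc k) (parts rest)
    ≡⟨ cong₂ (λ s t → v₀ + (s + t) + schmidtWeight (suc k) (parts rest))
         (total-tabulate value (r ∘ Fin.suc)) (total-concatRows value rows) ⟩
  v₀ + (S + R) + schmidtWeight (suc k) (parts rest)
    ≡⟨ cong (v₀ + (S + R) +_) (schmidtWeight-parts-concatRows k rows) ⟩
  v₀ + (S + R) + W
    ≡⟨ solve 4 (λ v s t w → v :+ (s :+ t) :+ w := con 1 :* (v :+ s) :+ (t :+ w)) refl v₀ S R W ⟩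
  1 * (v₀ + S) + (R + W)
    ≡⟨ cong (1 * (v₀ + S) +_) (weightedSum-+ᶜ (λ _ → 1) suc _ rows) ⟨
  weightedSum suc (λ r → ∑[ j < suc k ] value (r j)) (r ∷ rows) ∎
  where
  open ≡-Reasoning
  v₀ = value (r Fin.zero)
  xs = tabulate (r ∘ Fin.suc)
  rest = concatRows rows
  S = ∑[ j < k ] value (r (Fin.suc j))
  R = total (λ r → ∑[ j < suc k ] value (r j)) rows
  W = weightedSum suc (λ r → ∑[ j < suc k ] value (r j)) rows

sizeTuple-map-parts : ∀ {k} (v : Vec (List Gap) k) →
  sizeTuple (Vec.map parts v) ≡ ∑[ j < k ] weightedSum suc value (lookup v j)
sizeTuple-map-parts Vec.[] = refl
sizeTuple-map-parts (d Vec.∷ v) = cong₂ _+_ (size-parts d) (sizeTuple-map-parts v)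

overlinedTuple-map-parts : ∀ {k} (v : Vec (List Gap) k) →
  overlinedTuple (Vec.map parts v) ≡ ∑[ j < k ] total flag (lookup v j)
overlinedTuple-map-parts Vec.[] = refl
overlinedTuple-map-parts (d Vec.∷ v) = cong₂ _+_ (overlined-parts d) (overlinedTuple-map-parts v)

schmidtWeight-interleave : ∀ k (v : Vec (List Gap) (suc k)) →
  schmidtWeight (suc k) (parts (interleave v)) ≡ sizeTuple (Vec.map parts v)
schmidtWeight-interleave k v = begin
  schmidtWeight (suc k) (parts (interleave v))
    ≡⟨ schmidtGo-parts-strip (suc k) 0 (concatRows (rows v)) ⟩
  schmidtWeight (suc k) (parts (concatRows (rows v)))
    ≡⟨ schmidtWeight-parts-concatRows k (rows v) ⟩
  weightedSum suc (λ r → ∑[ j < suc k ] value (r j)) (rows v)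
    ≡⟨ weightedSum-rows refl v ⟩
  ∑[ j < suc k ] weightedSum suc value (lookup v j)
    ≡⟨ sizeTuple-map-parts v ⟨
  sizeTuple (Vec.map parts v) ∎
  where open ≡-Reasoning

overlined-interleave : ∀ {k} (v : Vec (List Gap) k) →
  overlined (parts (interleave v)) ≡ overlinedTuple (Vec.map parts v)
overlined-interleave {k} v = begin
  overlined (parts (interleave v))                  ≡⟨ overlined-parts (interleave v) ⟩
  total flag (interleave v)                         ≡⟨ weightedSum-strip refl (concatRows (rows v)) ⟩
  total flag (concatRows (rows v))                  ≡⟨ total-concatRows flag (rows v) ⟩
  total (λ r → ∑[ j < k ] flag (r j)) (rows v)      ≡⟨ weightedSum-rows refl v ⟩
  ∑[ j < k ] total flag (lookup v j)                ≡⟨ overlinedTuple-map-parts v ⟨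
  overlinedTuple (Vec.map parts v)                  ∎
  where open ≡-Reasoning

SchmidtGaps : (k n s : ℕ) → Set
SchmidtGaps k n s = Σ (List Gap) (λ d →
  Canonical d × schmidtWeight k (parts d) ≡ n × overlined (parts d) ≡ s)

TupleGaps : (k n s : ℕ) → Set
TupleGaps k n s = Σ (Vec (List Gap) k) (λ v →
  CanonicalTuple v × sizeTuple (Vec.map parts v) ≡ n × overlinedTuple (Vec.map parts v) ≡ s)

schmidt↔gaps : ∀ k n s → SchmidtSet k n s ↔ SchmidtGaps k n s
schmidt↔gaps k n s =
  ↔-restrict (statistics-irrelevant T-irrelevant) (statistics-irrelevant canonical-irrelevant) gaps parts
    (λ {l} (v , w , o) → gaps-canonical l v ,
       trans (cong (schmidtWeight k) (parts-gaps l v)) w , trans (cong overlined (parts-gaps l v)) o)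
    (λ {d} (c , w , o) → parts-valid d c , w , o)
    (λ {l} (v , _) → parts-gaps l v)
    (λ {d} _ → gaps-parts d)

map-gaps-canonical : ∀ {k} (v : Vec (List Part) k) → T (allOverpartitions v) →
  CanonicalTuple (Vec.map gaps v)
map-gaps-canonical Vec.[] _ = refl
map-gaps-canonical (l Vec.∷ v) a = let (a₁ , a₂) = Equivalence.to T-∧ a in
  cong₂ Vec._∷_ (gaps-canonical l a₁) (map-gaps-canonical v a₂)

map-parts-valid : ∀ {k} (v : Vec (List Gap) k) → CanonicalTuple v →
  T (allOverpartitions (Vec.map parts v))
map-parts-valid Vec.[] _ = tt
map-parts-valid (d Vec.∷ v) c = let (c₁ , c₂) = Vec.∷-injective c in
  Equivalence.from T-∧ (parts-valid d c₁ , map-parts-valid v c₂)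

map-parts-gaps : ∀ {k} (v : Vec (List Part) k) → T (allOverpartitions v) →
  Vec.map parts (Vec.map gaps v) ≡ v
map-parts-gaps Vec.[] _ = refl
map-parts-gaps (l Vec.∷ v) a = let (a₁ , a₂) = Equivalence.to T-∧ a in
  cong₂ Vec._∷_ (parts-gaps l a₁) (map-parts-gaps v a₂)

map-gaps-parts : ∀ {k} (v : Vec (List Gap) k) → Vec.map gaps (Vec.map parts v) ≡ v
map-gaps-parts Vec.[] = refl
map-gaps-parts (d Vec.∷ v) = cong₂ Vec._∷_ (gaps-parts d) (map-gaps-parts v)

tuple↔gaps : ∀ k n s → TupleSet k n s ↔ TupleGaps k n s
tuple↔gaps k n s =
  ↔-restrict (statistics-irrelevant T-irrelevant) (statistics-irrelevant canonicalTuple-irrelevant)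
    (Vec.map gaps) (Vec.map parts)
    (λ {v} (a , w , o) → map-gaps-canonical v a ,
       trans (cong sizeTuple (map-parts-gaps v a)) w , trans (cong overlinedTuple (map-parts-gaps v a)) o)
    (λ {v} (c , w , o) → map-parts-valid v c , w , o)
    (λ {v} (a , _) → map-parts-gaps v a)
    (λ {v} _ → map-gaps-parts v)

tupleGaps↔schmidtGaps : ∀ k n s → TupleGaps (suc k) n s ↔ SchmidtGaps (suc k) n s
tupleGaps↔schmidtGaps k n s =
  ↔-restrict (statistics-irrelevant canonicalTuple-irrelevant) (statistics-irrelevant canonical-irrelevant)
    interleave (columns (suc k))
    (λ {v} (_ , w , o) → strip-canonical (concatRows (rows v)) ,
       trans (schmidtWeight-interleave k v) w , trans (overlined-interleave v) o)
    (λ {d} (c , w , o) → columns-canonical (suc k) d ,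
       trans (sizeTuple-columns c) w , trans (overlinedTuple-columns c) o)
    (λ (c , _) → columns-interleave (suc k) c)
    (λ (c , _) → interleave-columns (suc k) c)
  where
  sizeTuple-columns : ∀ {d} → Canonical d →
    sizeTuple (Vec.map parts (columns (suc k) d)) ≡ schmidtWeight (suc k) (parts d)
  sizeTuple-columns {d} c = trans (sym (schmidtWeight-interleave k (columns (suc k) d)))
                                  (cong (schmidtWeight (suc k) ∘ parts) (interleave-columns (suc k) c))
  overlinedTuple-columns : ∀ {d} → Canonical d →
    overlinedTuple (Vec.map parts (columns (suc k) d)) ≡ overlined (parts d)
  overlinedTuple-columns {d} c = trans (sym (overlined-interleave (columns (suc k) d)))
                                       (cong (overlined ∘ parts) (interleave-columns (suc k) c))

corollary6 : (n k s : ℕ) → 1 ≤ n → 1 ≤ k → TupleSet k n s ↔ SchmidtSet k n s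
corollary6 n (suc k) s _ _ =
  ↔-trans (tuple↔gaps (suc k) n s)
    (↔-trans (tupleGaps↔schmidtGaps k n s) (↔-sym (schmidt↔gaps (suc k) n s)))
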